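{- Let $m\geq 3$ be even and let $k\geq 1$ be an integer with $k\leq m-1$. Let $H^*$ be the graph with vertex set $W_1\cup\dots\cup W_{k-1}\cup\{v_1,\dots,v_k\}$, where the $W_i$ are pairwise disjoint sets with $|W_i|=m-2$, constructed as follows: for $i=1,\dots,k-1$ let $H'_i$ be the graph on $W_i\cup\{v_i\}$ in which $W_i$ induces a complete graph $K_{m-2}$ and $v_i$ is adjacent to exactly $m-3$ vertices of $W_i$ (all except one vertex $w_i\in W_i$); let $H'_k$ be the single vertex $v_k$; and let $H^*=H'_1\oplus H'_2\oplus\dots\oplus H'_k$ be the join of these graphs. (Thus $|V(H^*)|=(k-1)(m-1)+1$ and $H^*$ is the complete graph on these vertices minus the $k-1$ edges $v_iw_i$.) Let $\mathcal{F}$ be the family of connected graphs on $m$ vertices that are subgraphs of the graph obtained from $K_m$ by deleting the edges of a perfect matching ($\frac{m}{2}K_2$). Then for every $G\in\mathcal{F}$, $H^*$ is $k$-$G$-free-vertex-minimal.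
   Context: All graphs are finite, simple and undirected. The join $A\oplus B$ of graphs $A,B$ is obtained from their disjoint union by joining every vertex of $A$ to every vertex of $B$. For a graph $G$ on at least 2 vertices, a $G$-free $k$-colouring of a graph $H$ is a map $\pi:V(H)\to\{1,\dots,k\}$ such that for every $i$ the subgraph of $H$ induced by $\pi^{ -1}(i)$ contains no subgraph isomorphic to $G$. The $G$-free chromatic number $\chi_G(H)$ is the least $k$ for which a $G$-free $k$-colouring of $H$ exists. $H$ is $G$-free-vertex-minimal if $\chi_G(H\setminus\{v\})\leq\chi_G(H)-1$ for every vertex $v$; $H$ is $k$-$G$-free-vertex-minimal if moreover $\chi_G(H)=k$. -}

module Defs where

open import Level using (0ℓ)
open import Data.Nat using (ℕ; zero; suc; _+_; _*_; _∸_; _≤_; _<_)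
open import Data.Fin using (Fin; toℕ; punchIn)
open import Data.Product using (Σ; _×_; ∃; _,_)
open import Data.Sum using (_⊎_)
open import Relation.Nullary using (¬_)
open import Relation.Binary.PropositionalEquality using (_≡_; _≢_)
open import Function.Definitions using (Injective)

record Graph (n : ℕ) : Set₁ where
  field
    Adj    : Fin n → Fin n → Set
    sym    : ∀ {x y} → Adj x y → Adj y x
    irrefl : ∀ {x} → ¬ Adj x x
open Graph public

deleteVertex : ∀ {n} → Graph (suc n) → Fin (suc n) → Graph n
deleteVertex H v = record
  { Adj    = λ x y → Adj H (punchIn v x) (punchIn v y)
  ; sym    = sym H
  ; irrefl = irrefl H }

-- The subgraph of H induced by the vertex set {x | S x} contains a subgraph
-- isomorphic to G: an injective edge-preserving map V(G) → V(H) landing in S.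
ContainsIn : ∀ {m n} → Graph n → (Fin n → Set) → Graph m → Set
ContainsIn {m} {n} H S G =
  Σ (Fin m → Fin n) λ f →
    Injective _≡_ _≡_ f × (∀ i → S (f i)) × (∀ i j → Adj G i j → Adj H (f i) (f j))

IsGFreeColouring : ∀ {m n} → Graph m → Graph n → (k : ℕ) → (Fin n → Fin k) → Set
IsGFreeColouring G H k π = ∀ (c : Fin k) → ¬ ContainsIn H (λ x → π x ≡ c) G

HasGFreeColouring : ∀ {m n} → Graph m → Graph n → ℕ → Set
HasGFreeColouring {n = n} G H k = Σ (Fin n → Fin k) (IsGFreeColouring G H k)

ChiIs : ∀ {m n} → Graph m → Graph n → ℕ → Set
ChiIs G H k = HasGFreeColouring G H k × (∀ j → j < k → ¬ HasGFreeColouring G H j)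

KGFreeVertexMinimal : ∀ {m n} → Graph m → Graph (suc n) → ℕ → Set
KGFreeVertexMinimal G H k =
  ChiIs G H k ×
  (∀ v → Σ ℕ λ j → ChiIs G (deleteVertex H v) j × j ≤ k ∸ 1)

data Reachable {n : ℕ} (G : Graph n) : Fin n → Fin n → Set where
  here : ∀ {x} → Reachable G x x
  step : ∀ {x y z} → Adj G x y → Reachable G y z → Reachable G x z

Connected : ∀ {n} → Graph n → Set
Connected {n} G = ∀ (x y : Fin n) → Reachable G x y

IsPerfectMatching : ∀ {m} → (Fin m → Fin m) → Set
IsPerfectMatching μ = (∀ i → μ (μ i) ≡ i) × (∀ i → μ i ≢ i)

InFamily : ∀ {m} → Graph m → Set
InFamily {m} G =
  Connected G ×
  Σ (Fin m → Fin m) λ μ → IsPerfectMatching μ × (∀ i j → Adj G i j → j ≢ μ i)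

-- Block q (q < k-1) occupies
-- q(m-1) .. q(m-1)+(m-2): W_q = offsets 0..m-3 (with w_q at offset 0),
-- v_q at offset m-2. The last vertex (k-1)(m-1) is v_k.
MissingPair : (m k : ℕ) → ℕ → ℕ → Set
MissingPair m k a b =
  ∃ λ q → q < k ∸ 1 × a ≡ q * (m ∸ 1) × b ≡ q * (m ∸ 1) + (m ∸ 2)

HStar : (m k : ℕ) → Graph (suc ((k ∸ 1) * (m ∸ 1)))
HStar m k = record
  { Adj    = λ x y → x ≢ y ×
               ¬ (MissingPair m k (toℕ x) (toℕ y) ⊎ MissingPair m k (toℕ y) (toℕ x))
  ; sym    = λ { (ne , nm) → (λ e → ne (Relation.Binary.PropositionalEquality.sym e)) ,
                             (λ p → nm (Data.Sum.swap p)) }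
  ; irrefl = λ { (ne , _) → ne Relation.Binary.PropositionalEquality.refl } }
  where import Relation.Binary.PropositionalEquality
        import Data.Sum

module Submission where

-- H* is the complete graph K_n, n = (k-1)(m-1)+1, minus a matching. Any m of its vertices
-- therefore span K_m minus a partial matching; permuting them so that this partial matching
-- lies inside the perfect matching μ avoided by G (both matchings are brought to the canonical
-- form {0,1}, {2,3}, …) shows that every m vertices of H*, and of H* - v, contain G. So a
-- G-free colouring has classes of at most m - 1 vertices, and colouring consecutive blocks of
-- m - 1 vertices is optimal: χ_G(H*) = k and χ_G(H* - v) = k - 1.

open import Level using (0ℓ)
open import Data.Nat using (ℕ; zero; suc; _+_; _*_; _∸_; _≤_; _<_; z≤n; s≤s; _≟_; _≤?_; _<?_)
open import Data.Nat.Properties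
open import Data.Nat.Divisibility using (_∣_)
open import Data.Nat.DivMod using (_%_; m<n⇒m%n≡m; [m+kn]%n≡m%n; m*n%n≡0)
open import Data.Fin using (Fin; toℕ; fromℕ<; punchIn; inject≤; quotient; remainder; combine)
  renaming (zero to fzero; suc to fsuc)
open import Data.Fin.Properties
  using (toℕ-injective; toℕ<n; toℕ-fromℕ<; any?; pigeonhole; punchIn-injective; inject≤-injective; combine-remQuot)
  renaming (_≟_ to _≟ᶠ_; <⇒≢ to <⇒≢ᶠ)
open import Data.Fin.Permutation using (Permutation′; _⟨$⟩ʳ_; _⟨$⟩ˡ_; inverseʳ; transpose; id; flip; _∘ₚ_)
open import Data.List using (List; _∷_; length; filter; lookup; allFin)
open import Data.List.Properties using (length-tabulate)
open import Data.List.Membership.Propositional.Properties using (∈-lookup)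
open import Data.List.Relation.Unary.All as All using (All; _∷_)
import Data.List.Relation.Unary.All.Properties as All
open import Data.List.Relation.Unary.AllPairs using (_∷_)
open import Data.List.Relation.Unary.Unique.Propositional using (Unique)
import Data.List.Relation.Unary.Unique.Propositional.Properties as Unique
open import Data.List.Relation.Ternary.Interleaving.Properties using (interleave-length)
import Data.List.Relation.Ternary.Interleaving.Propositional.Properties as Interleaving
open import Data.Product using (Σ; _×_; ∃; ∃₂; _,_; proj₁; proj₂)
open import Data.Sum using (_⊎_; inj₁; inj₂)
open import Function using (_∘_; _on_)
open import Function.Bundles using (Injection)
open import Function.Definitions using (Injective)
open import Function.Properties.Inverse using (↔⇒↣)
open import Relation.Binary using (Rel; Symmetric; Decidable; tri<; tri≈; tri>)
open import Relation.Binary.PropositionalEquality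
open import Relation.Nullary using (¬_; Dec; yes; no; contradiction)
open import Relation.Nullary.Decidable using (_×-dec_; _⊎-dec_; ¬?; decidable-stable)
open import Defs hiding (sym)

-- Partial matchings and their canonical form

record IsPartialMatching {n} (R : Rel (Fin n) 0ℓ) : Set where
  field
    symmetric   : Symmetric R
    functional  : ∀ {a b c} → R a b → R a c → b ≡ c
    irreflexive : ∀ {a} → ¬ R a a
    decidable   : Decidable R

isPartialMatching-on : ∀ {m n} {R : Rel (Fin n) 0ℓ} {f : Fin m → Fin n} →
  Injective _≡_ _≡_ f → IsPartialMatching R → IsPartialMatching (R on f)
isPartialMatching-on {f = f} f-injective M = record
  { symmetric   = symmetric
  ; functional  = λ r r′ → f-injective (functional r r′)
  ; irreflexive = irreflexive
  ; decidable   = λ a b → decidable (f a) (f b)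
  }
  where open IsPartialMatching M

perfectMatching-isPartialMatching : ∀ {n} {μ : Fin n → Fin n} →
  IsPerfectMatching μ → IsPartialMatching (λ a b → b ≡ μ a)
perfectMatching-isPartialMatching {μ = μ} (involutive , fixpointFree) = record
  { symmetric   = λ {a} b≡μa → trans (sym (involutive a)) (cong μ (sym b≡μa))
  ; functional  = λ b≡μa c≡μa → trans b≡μa (sym c≡μa)
  ; irreflexive = λ {a} a≡μa → fixpointFree a (sym a≡μa)
  ; decidable   = λ a b → b ≟ᶠ μ a
  }

⟨$⟩ʳ-injective : ∀ {n} (σ : Permutation′ n) → Injective _≡_ _≡_ (σ ⟨$⟩ʳ_)
⟨$⟩ʳ-injective σ = Injection.injective (↔⇒↣ σ)

transpose-here : ∀ {n} (i j : Fin n) → transpose i j ⟨$⟩ʳ i ≡ j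
transpose-here i j with i ≟ᶠ i
... | yes _  = refl
... | no i≢i = contradiction refl i≢i

transpose-fixes : ∀ {n} {i j k : Fin n} → k ≢ i → k ≢ j → transpose i j ⟨$⟩ʳ k ≡ k
transpose-fixes {i = i} {j} {k} k≢i k≢j with k ≟ᶠ i
... | yes k≡i = contradiction k≡i k≢i
... | no _ with k ≟ᶠ j
...   | yes k≡j = contradiction k≡j k≢j
...   | no _    = refl

partner : ℕ → ℕ
partner 0             = 1
partner 1             = 0
partner (suc (suc a)) = suc (suc (partner a))

partner-< : ∀ t {a} → a < t * 2 → partner a < t * 2
partner-< (suc t) {0}           _                = s≤s (s≤s z≤n)
partner-< (suc t) {1}           _                = s≤s z≤n
partner-< (suc t) {suc (suc a)} (s≤s (s≤s a<2t)) = s≤s (s≤s (partner-< t a<2t))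

partner-even : ∀ t → partner (t * 2) ≡ suc (t * 2)
partner-even zero    = refl
partner-even (suc t) = cong (suc ∘ suc) (partner-even t)

partner-odd : ∀ t → partner (suc (t * 2)) ≡ t * 2
partner-odd zero    = refl
partner-odd (suc t) = cong (suc ∘ suc) (partner-odd t)

module _ {n : ℕ} where

  CanonicalBelow : ℕ → Rel (Fin n) 0ℓ → Set
  CanonicalBelow t R = ∀ {a b} → toℕ a < t * 2 → R a b → toℕ b ≡ partner (toℕ a)

  Canonical : Rel (Fin n) 0ℓ → Set
  Canonical R = ∀ {a b} → R a b → toℕ b ≡ partner (toℕ a)

  canonicalBelow-on : ∀ {t R} (σ : Permutation′ n) → (∀ {a} → toℕ a < t * 2 → σ ⟨$⟩ʳ a ≡ a) →
    CanonicalBelow t R → CanonicalBelow t (R on (σ ⟨$⟩ʳ_))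
  canonicalBelow-on {t} {R} σ fixes canonical {a} {b} a<2t a~b =
    trans (cong toℕ (sym σb≡b)) σb-partner
    where
      σb-partner : toℕ (σ ⟨$⟩ʳ b) ≡ partner (toℕ a)
      σb-partner = canonical a<2t (subst (λ x → R x (σ ⟨$⟩ʳ b)) (fixes a<2t) a~b)
      σb≡b : σ ⟨$⟩ʳ b ≡ b
      σb≡b = ⟨$⟩ʳ-injective σ (fixes (subst (_< t * 2) (sym σb-partner) (partner-< t a<2t)))

  transpose-fixes-below : ∀ {p} {i j : Fin n} → p ≤ toℕ i → p ≤ toℕ j →
    ∀ {a} → toℕ a < p → transpose i j ⟨$⟩ʳ a ≡ a
  transpose-fixes-below p≤i p≤j a<p =
    transpose-fixes (<⇒≢ᶠ (<-≤-trans a<p p≤i)) (<⇒≢ᶠ (<-≤-trans a<p p≤j))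

  module _ {R : Rel (Fin n) 0ℓ} (M : IsPartialMatching R) where
    open IsPartialMatching M

    partner-above : ∀ {t a b} → CanonicalBelow t R → toℕ a ≡ t * 2 → R a b → t * 2 < toℕ b
    partner-above {t} {a} {b} canonical a≡2t a~b with <-cmp (toℕ b) (t * 2)
    ... | tri< b<2t _ _ =
      contradiction (subst (_< t * 2) (sym (canonical b<2t (symmetric a~b))) (partner-< t b<2t))
                    (subst (λ x → ¬ x < t * 2) (sym a≡2t) (n≮n (t * 2)))
    ... | tri≈ _ b≡2t _ = contradiction (subst (R a) (toℕ-injective (trans b≡2t (sym a≡2t))) a~b) irreflexive
    ... | tri> _ _ 2t<b = 2t<b

    canonicalBelow-suc : ∀ {t p q} → CanonicalBelow t R → toℕ p ≡ t * 2 → toℕ q ≡ suc (t * 2) →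
      R p q → CanonicalBelow (suc t) R
    canonicalBelow-suc {t} {p} {q} canonical p≡2t q≡2t+1 p~q {a} {b} a<2t+2 a~b
      with <-cmp (toℕ a) (t * 2)
    ... | tri< a<2t _ _ = canonical a<2t a~b
    ... | tri≈ _ a≡2t _ = begin
      toℕ b                ≡⟨ cong toℕ (functional a~b a~q) ⟩
      toℕ q                ≡⟨ q≡2t+1 ⟩
      suc (t * 2)          ≡⟨ partner-even t ⟨
      partner (t * 2)      ≡⟨ cong partner a≡2t ⟨
      partner (toℕ a)      ∎
      where
        open ≡-Reasoning
        a~q : R a q
        a~q = subst (λ x → R x q) (toℕ-injective (trans p≡2t (sym a≡2t))) p~q
    ... | tri> _ _ 2t<a = begin
      toℕ b                 ≡⟨ cong toℕ (functional a~b a~p) ⟩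
      toℕ p                 ≡⟨ p≡2t ⟩
      t * 2                 ≡⟨ partner-odd t ⟨
      partner (suc (t * 2)) ≡⟨ cong partner a≡2t+1 ⟨
      partner (toℕ a)       ∎
      where
        open ≡-Reasoning
        a≡2t+1 : toℕ a ≡ suc (t * 2)
        a≡2t+1 = ≤-antisym (≤-pred a<2t+2) 2t<a
        a~p : R a p
        a~p = subst (λ x → R x p) (toℕ-injective (trans q≡2t+1 (sym a≡2t+1))) (symmetric p~q)

  -- Move a pair of R to the positions 2t, 2t+1 by two transpositions that fix the first t pairs.
  extendCanonicalBelow : ∀ {R t r y} → IsPartialMatching R → CanonicalBelow t R → t * 2 ≤ toℕ r → R r y →
    Σ (Permutation′ n) λ σ → CanonicalBelow (suc t) (R on (σ ⟨$⟩ʳ_))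
  extendCanonicalBelow {R} {t} {r} {y} M canonical 2t≤r r~y =
    σ₂ ∘ₚ σ₁ , canonicalBelow-suc M₂ {t} canonical₂ p≡2t p′≡2t+1 p~p′
    where
      p : Fin n
      p = fromℕ< (≤-<-trans 2t≤r (toℕ<n r))
      p≡2t : toℕ p ≡ t * 2
      p≡2t = toℕ-fromℕ< _
      σ₁ = transpose p r
      M₁ = isPartialMatching-on (⟨$⟩ʳ-injective σ₁) M
      canonical₁ : CanonicalBelow t (R on (σ₁ ⟨$⟩ʳ_))
      canonical₁ = canonicalBelow-on {t} {R} σ₁
        (transpose-fixes-below (≤-reflexive (sym p≡2t)) 2t≤r) canonical
      s : Fin n
      s = σ₁ ⟨$⟩ˡ y
      p~s : R (σ₁ ⟨$⟩ʳ p) (σ₁ ⟨$⟩ʳ s)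
      p~s = subst₂ R (sym (transpose-here p r)) (sym (inverseʳ σ₁)) r~y
      2t<s : t * 2 < toℕ s
      2t<s = partner-above M₁ {t} canonical₁ p≡2t p~s
      p′ : Fin n
      p′ = fromℕ< (<-≤-trans (s≤s 2t<s) (toℕ<n s))
      p′≡2t+1 : toℕ p′ ≡ suc (t * 2)
      p′≡2t+1 = toℕ-fromℕ< _
      σ₂ = transpose p′ s
      M₂ = isPartialMatching-on (⟨$⟩ʳ-injective σ₂) M₁
      canonical₂ : CanonicalBelow t (R on ((σ₂ ∘ₚ σ₁) ⟨$⟩ʳ_))
      canonical₂ = canonicalBelow-on {t} σ₂
        (transpose-fixes-below (≤-trans (n≤1+n _) (≤-reflexive (sym p′≡2t+1))) (<⇒≤ 2t<s)) canonical₁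
      p~p′ : R ((σ₂ ∘ₚ σ₁) ⟨$⟩ʳ p) ((σ₂ ∘ₚ σ₁) ⟨$⟩ʳ p′)
      p~p′ = subst₂ (λ x y → R (σ₁ ⟨$⟩ʳ x) (σ₁ ⟨$⟩ʳ y))
        (sym (transpose-fixes-below (≤-reflexive (sym p′≡2t+1)) 2t<s (≤-reflexive (cong suc p≡2t))))
        (sym (transpose-here p′ s)) p~s

  MatchedAbove : ℕ → Rel (Fin n) 0ℓ → Set
  MatchedAbove t R = ∃ λ r → t * 2 ≤ toℕ r × ∃ (R r)

  matchedAbove? : ∀ {R} → IsPartialMatching R → ∀ t → Dec (MatchedAbove t R)
  matchedAbove? M t = any? (λ r → (t * 2 ≤? toℕ r) ×-dec any? (IsPartialMatching.decidable M r))

  ¬matchedAbove⇒canonical : ∀ {R t} → CanonicalBelow t R → ¬ MatchedAbove t R → Canonical R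
  ¬matchedAbove⇒canonical {t = t} canonical unmatched {a} {b} a~b with toℕ a <? t * 2
  ... | yes a<2t = canonical a<2t a~b
  ... | no a≮2t  = contradiction (a , ≮⇒≥ a≮2t , b , a~b) unmatched

  -- The fuel bounds the number of pairs still to be moved into place.
  canonicalise-from : ∀ {R} fuel t → IsPartialMatching R → CanonicalBelow t R → n ≤ t * 2 + fuel →
    Σ (Permutation′ n) λ σ → Canonical (R on (σ ⟨$⟩ʳ_))
  canonicalise-from zero t M canonical n≤2t =
    id , λ {a} → canonical (<-≤-trans (toℕ<n a) (≤-trans n≤2t (≤-reflexive (+-identityʳ _))))
  canonicalise-from (suc fuel) t M canonical n≤ with matchedAbove? M t
  ... | no unmatched = id , ¬matchedAbove⇒canonical {t = t} canonical unmatched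
  ... | yes (r , 2t≤r , y , r~y) = τ ∘ₚ σ , canonical″
    where
      extended = extendCanonicalBelow {t = t} M canonical 2t≤r r~y
      σ = proj₁ extended
      rest = canonicalise-from fuel (suc t) (isPartialMatching-on (⟨$⟩ʳ-injective σ) M) (proj₂ extended)
               (≤-trans n≤ (≤-trans (≤-reflexive (+-suc (t * 2) fuel)) (n≤1+n _)))
      τ = proj₁ rest
      canonical″ = proj₂ rest

  canonicalise : ∀ {R} → IsPartialMatching R → Σ (Permutation′ n) λ σ → Canonical (R on (σ ⟨$⟩ʳ_))
  canonicalise M = canonicalise-from n 0 M (λ ()) ≤-refl

  -- Canonicalise both matchings; ρ undoes the canonicalisation of μ and then applies that of Q.
  alignWithPerfectMatching : ∀ {Q : Rel (Fin n) 0ℓ} {μ} → IsPartialMatching Q → IsPerfectMatching μ →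
    Σ (Permutation′ n) λ ρ → ∀ {i j} → Q (ρ ⟨$⟩ʳ i) (ρ ⟨$⟩ʳ j) → j ≡ μ i
  alignWithPerfectMatching {Q} {μ} M perfect with canonicalise M | canonicalise (perfectMatching-isPartialMatching perfect)
  ... | σ , canonicalQ | τ , canonicalμ = flip τ ∘ₚ σ , aligned
    where
      aligned : ∀ {i j} → Q (σ ⟨$⟩ʳ (τ ⟨$⟩ˡ i)) (σ ⟨$⟩ʳ (τ ⟨$⟩ˡ j)) → j ≡ μ i
      aligned {i} {j} i~j = begin
        j                        ≡⟨ inverseʳ τ ⟨
        τ ⟨$⟩ʳ (τ ⟨$⟩ˡ j)        ≡⟨ cong (τ ⟨$⟩ʳ_) (toℕ-injective samePartner) ⟩
        τ ⟨$⟩ʳ (τ ⟨$⟩ˡ (μ i))    ≡⟨ inverseʳ τ ⟩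
        μ i                      ∎
        where
          open ≡-Reasoning
          μ-pair : τ ⟨$⟩ʳ (τ ⟨$⟩ˡ (μ i)) ≡ μ (τ ⟨$⟩ʳ (τ ⟨$⟩ˡ i))
          μ-pair = trans (inverseʳ τ) (cong μ (sym (inverseʳ τ)))
          samePartner : toℕ (τ ⟨$⟩ˡ j) ≡ toℕ (τ ⟨$⟩ˡ (μ i))
          samePartner = trans (canonicalQ i~j) (sym (canonicalμ μ-pair))

-- Complete graphs minus a matching

NonEdge : ∀ {n} → Graph n → Rel (Fin n) 0ℓ
NonEdge H x y = x ≢ y × ¬ Adj H x y

record IsCompleteMinusMatching {n} (H : Graph n) : Set where
  field
    adjacent?          : Decidable (Adj H)
    nonEdge-functional : ∀ {x y z} → NonEdge H x y → NonEdge H x z → y ≡ z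

nonEdge-isPartialMatching : ∀ {n} {H : Graph n} → IsCompleteMinusMatching H → IsPartialMatching (NonEdge H)
nonEdge-isPartialMatching {H = H} completeMinusMatching = record
  { symmetric   = λ (x≢y , x≁y) → x≢y ∘ sym , x≁y ∘ Graph.sym H
  ; functional  = nonEdge-functional
  ; irreflexive = λ (x≢x , _) → x≢x refl
  ; decidable   = λ x y → ¬? (x ≟ᶠ y) ×-dec ¬? (adjacent? x y)
  }
  where open IsCompleteMinusMatching completeMinusMatching

Spans : ∀ {m n} → Graph n → (Fin m → Fin n) → Graph m → Set
Spans {m} H h G =
  Σ (Fin m → Fin m) λ ρ → Injective _≡_ _≡_ ρ × (∀ i j → Adj G i j → Adj H (h (ρ i)) (h (ρ j)))

EverySubsetContains : ∀ {m n} → Graph m → Graph n → Set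
EverySubsetContains {m} {n} G H = ∀ (h : Fin m → Fin n) → Injective _≡_ _≡_ h → Spans H h G

CocktailPartySubgraph : ∀ {m} → Graph m → Set
CocktailPartySubgraph {m} G =
  Σ (Fin m → Fin m) λ μ → IsPerfectMatching μ × (∀ i j → Adj G i j → j ≢ μ i)

cocktailParty-in-completeMinusMatching : ∀ {m n} {G : Graph m} {H : Graph n} →
  CocktailPartySubgraph G → IsCompleteMinusMatching H → EverySubsetContains G H
cocktailParty-in-completeMinusMatching {G = G} {H} (μ , perfect , avoidsμ) completeMinusMatching h h-injective
  with alignWithPerfectMatching (isPartialMatching-on h-injective (nonEdge-isPartialMatching completeMinusMatching)) perfect
... | ρ , aligned = ρ ⟨$⟩ʳ_ , ⟨$⟩ʳ-injective ρ , edge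
  where
    open IsCompleteMinusMatching completeMinusMatching
    edge : ∀ i j → Adj G i j → Adj H (h (ρ ⟨$⟩ʳ i)) (h (ρ ⟨$⟩ʳ j))
    edge i j i~j = decidable-stable (adjacent? _ _) λ i≁j → avoidsμ i j i~j (aligned (distinct , i≁j))
      where
        distinct : h (ρ ⟨$⟩ʳ i) ≢ h (ρ ⟨$⟩ʳ j)
        distinct e = irrefl G (subst (Adj G i) (sym (⟨$⟩ʳ-injective ρ (h-injective e))) i~j)

everySubsetContains-deleteVertex : ∀ {m n} {G : Graph m} {H : Graph (suc n)} →
  EverySubsetContains G H → ∀ v → EverySubsetContains G (deleteVertex H v)
everySubsetContains-deleteVertex contains v h h-injective =
  contains (punchIn v ∘ h) (h-injective ∘ punchIn-injective v _ _)

-- Colourings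

length-filter-¬filter : ∀ {A : Set} {P : A → Set} (P? : ∀ x → Dec (P x)) xs →
  length xs ≡ length (filter P? xs) + length (filter (¬? ∘ P?) xs)
length-filter-¬filter P? xs = interleave-length (Interleaving.filter⁺ P? xs)

pigeonhole-List : ∀ {A : Set} (f : A → ℕ) j d (xs : List A) → Unique xs → All (λ x → f x < j) xs →
  j * d < length xs → ∃₂ λ c ys → Unique ys × All (λ y → f y ≡ c) ys × d < length ys
pigeonhole-List f zero    d (x ∷ xs) _ (() ∷ _) _
pigeonhole-List f (suc j) d xs unique bounded more with d <? length (filter (λ x → f x ≟ j) xs)
... | yes many = j , filter (λ x → f x ≟ j) xs , Unique.filter⁺ _ unique , All.all-filter _ xs , many
... | no few   = pigeonhole-List f j d rest (Unique.filter⁺ _ unique) rest-bounded rest-more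
  where
    rest = filter (λ x → ¬? (f x ≟ j)) xs
    rest-bounded : All (λ x → f x < j) rest
    rest-bounded = All.zipWith (λ (x<1+j , x≢j) → ≤∧≢⇒< (≤-pred x<1+j) x≢j)
      (All.filter⁺ _ bounded , All.all-filter _ xs)
    rest-more : j * d < length rest
    rest-more = +-cancelˡ-< d (j * d) (length rest) (begin-strict
      d + j * d                                           <⟨ more ⟩
      length xs                                           ≡⟨ length-filter-¬filter (λ x → f x ≟ j) xs ⟩
      length (filter (λ x → f x ≟ j) xs) + length rest    ≤⟨ +-monoˡ-≤ (length rest) (≮⇒≥ few) ⟩
      d + length rest                                     ∎)
      where open ≤-Reasoning

lookup-injective : ∀ {A : Set} {xs : List A} → Unique xs → Injective _≡_ _≡_ (lookup xs)
lookup-injective {xs = _ ∷ _} (_ ∷ _) {fzero} {fzero} _ = refl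
lookup-injective {xs = _ ∷ _} (x∉xs ∷ _) {fzero} {fsuc j} x≡ =
  contradiction x≡ (All.lookup x∉xs (∈-lookup j))
lookup-injective {xs = _ ∷ _} (x∉xs ∷ _) {fsuc i} {fzero} ≡x =
  contradiction (sym ≡x) (All.lookup x∉xs (∈-lookup i))
lookup-injective {xs = _ ∷ _} (_ ∷ unique) {fsuc i} {fsuc j} eq =
  cong fsuc (lookup-injective unique eq)

module _ {d n : ℕ} where

  monochromaticSubset : ∀ j (colour : Fin n → Fin j) → j * d < n →
    Σ (Fin (suc d) → Fin n) λ h → Injective _≡_ _≡_ h × (∀ i → colour (h i) ≡ colour (h fzero))
  monochromaticSubset j colour jd<n with
    pigeonhole-List (toℕ ∘ colour) j d (allFin n) (Unique.allFin⁺ n) (All.universal (toℕ<n ∘ colour) _)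
      (subst (j * d <_) (sym (length-tabulate {n = n} (λ x → x))) jd<n)
  ... | c , class , unique , hasColour , many =
    h , h-injective , λ i → toℕ-injective (trans (colour-h i) (sym (colour-h fzero)))
    where
      h : Fin (suc d) → Fin n
      h i = lookup class (inject≤ i many)
      h-injective : Injective _≡_ _≡_ h
      h-injective = inject≤-injective many many _ _ ∘ lookup-injective unique
      colour-h : ∀ i → toℕ (colour (h i)) ≡ c
      colour-h i = All.lookup hasColour (∈-lookup {xs = class} (inject≤ i many))

  module _ {G : Graph (suc d)} {H : Graph n} where

    blockColouring : ∀ c → n ≤ c * d → HasGFreeColouring G H c
    blockColouring c n≤cd = colour , free
      where
        block : Fin n → Fin (c * d)
        block x = inject≤ x n≤cd
        colour : Fin n → Fin c
        colour = quotient {c} d ∘ block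
        -- The d + 1 vertices of a copy of G cannot all have distinct remainders modulo d.
        free : IsGFreeColouring G H c colour
        free col (f , f-injective , inClass , _) with pigeonhole (n<1+n d) (λ i → remainder {c} d (block (f i)))
        ... | i , j , i<j , sameRemainder =
          <⇒≢ᶠ i<j (f-injective (inject≤-injective n≤cd n≤cd _ _ sameBlock))
          where
            open ≡-Reasoning
            sameBlock : block (f i) ≡ block (f j)
            sameBlock = begin
              block (f i)
                ≡⟨ combine-remQuot {c} d (block (f i)) ⟨
              combine (colour (f i)) (remainder {c} d (block (f i)))
                ≡⟨ cong₂ combine (trans (inClass i) (sym (inClass j))) sameRemainder ⟩
              combine (colour (f j)) (remainder {c} d (block (f j)))
                ≡⟨ combine-remQuot {c} d (block (f j)) ⟩
              block (f j)
                ∎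

    noFreeColouring : EverySubsetContains G H → ∀ j → j * d < n → ¬ HasGFreeColouring G H j
    noFreeColouring contains j jd<n (colour , free) with monochromaticSubset j colour jd<n
    ... | h , h-injective , monochromatic with contains h h-injective
    ...   | ρ , ρ-injective , edges =
      free (colour (h fzero)) (h ∘ ρ , ρ-injective ∘ h-injective , monochromatic ∘ ρ , edges)

    chromaticNumber : EverySubsetContains G H → ∀ c → n ≤ c * d → (∀ j → j < c → j * d < n) → ChiIs G H c
    chromaticNumber contains c n≤cd fewer =
      blockColouring c n≤cd , λ j j<c → noFreeColouring contains j (fewer j j<c)

-- H* is a complete graph minus a matching

-- With m = 3 + e, the offsets m ∸ 1 and m ∸ 2 in MissingPair are d and r.
module _ (e k : ℕ) where
  private
    d = 2 + e
    r = 1 + e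

  multiple≢multiple+offset : ∀ q q′ → q * d ≢ q′ * d + r
  multiple≢multiple+offset q q′ eq = 1+n≢0 (begin
    r                 ≡⟨ m<n⇒m%n≡m (n<1+n r) ⟨
    r % d             ≡⟨ [m+kn]%n≡m%n r q′ d ⟨
    (r + q′ * d) % d  ≡⟨ cong (_% d) (trans (+-comm r (q′ * d)) (sym eq)) ⟩
    q * d % d         ≡⟨ m*n%n≡0 q d ⟩
    0                 ∎)
    where open ≡-Reasoning

  missingPair? : Decidable (MissingPair (3 + e) k)
  missingPair? a b = anyUpTo? (λ q → (a ≟ q * d) ×-dec (b ≟ q * d + r)) (k ∸ 1)

  missingPair-offset : ∀ {a b} → MissingPair (3 + e) k a b → b ≡ a + r
  missingPair-offset (_ , _ , a≡qd , b≡qd+r) = trans b≡qd+r (cong (_+ r) (sym a≡qd))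

  missingPair-noChain : ∀ {a b c} → MissingPair (3 + e) k a b → ¬ MissingPair (3 + e) k c a
  missingPair-noChain (q , _ , a≡qd , _) (q′ , _ , _ , a≡q′d+r) =
    multiple≢multiple+offset q q′ (trans (sym a≡qd) a≡q′d+r)

  HStar-isCompleteMinusMatching : IsCompleteMinusMatching (HStar (3 + e) k)
  HStar-isCompleteMinusMatching = record { adjacent? = adjacent? ; nonEdge-functional = functional }
    where
      H = HStar (3 + e) k
      Missing : Rel (Fin _) 0ℓ
      Missing x y = MissingPair (3 + e) k (toℕ x) (toℕ y) ⊎ MissingPair (3 + e) k (toℕ y) (toℕ x)
      missing? : Decidable Missing
      missing? x y = missingPair? (toℕ x) (toℕ y) ⊎-dec missingPair? (toℕ y) (toℕ x)
      adjacent? : Decidable (Adj H)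
      adjacent? x y = ¬? (x ≟ᶠ y) ×-dec ¬? (missing? x y)
      missing : ∀ {x y} → NonEdge H x y → Missing x y
      missing (x≢y , x≁y) = decidable-stable (missing? _ _) λ ¬missing → x≁y (x≢y , ¬missing)
      missing-functional : ∀ {x y z} → Missing x y → Missing x z → toℕ y ≡ toℕ z
      missing-functional (inj₁ x→y) (inj₁ x→z) = trans (missingPair-offset x→y) (sym (missingPair-offset x→z))
      missing-functional (inj₂ y→x) (inj₂ z→x) =
        +-cancelʳ-≡ r _ _ (trans (sym (missingPair-offset y→x)) (missingPair-offset z→x))
      missing-functional (inj₁ x→y) (inj₂ z→x) = contradiction z→x (missingPair-noChain x→y)
      missing-functional (inj₂ y→x) (inj₁ x→z) = contradiction y→x (missingPair-noChain x→z)
      functional : ∀ {x y z} → NonEdge H x y → NonEdge H x z → y ≡ z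
      functional x≁y x≁z = toℕ-injective (missing-functional (missing x≁y) (missing x≁z))

theorem13 : (m k : ℕ) → 3 ≤ m → 2 ∣ m → 1 ≤ k → k ≤ m ∸ 1 →
    (G : Graph m) → InFamily G → KGFreeVertexMinimal G (HStar m k) k
theorem13 (suc (suc (suc e))) (suc k) _ _ _ _ G (_ , cocktailParty) =
  chromaticNumber {G = G} {H} contains (suc k) fitsInBlocks tooBigForFewer ,
  λ v → k , chromaticNumber {G = G} {deleteVertex H v} (contains-deleteVertex v) k ≤-refl tooBigForFewer′ , ≤-refl
  where
    d = 2 + e
    H = HStar (3 + e) (suc k)
    contains : EverySubsetContains G H
    contains = cocktailParty-in-completeMinusMatching {G = G} {H} cocktailParty
                 (HStar-isCompleteMinusMatching e (suc k))
    contains-deleteVertex : ∀ v → EverySubsetContains G (deleteVertex H v)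
    contains-deleteVertex = everySubsetContains-deleteVertex {G = G} {H} contains
    fitsInBlocks : suc (k * d) ≤ suc k * d
    fitsInBlocks = s≤s (m≤n+m (k * d) (suc e))
    tooBigForFewer : ∀ j → j < suc k → j * d < suc (k * d)
    tooBigForFewer j j≤k = s≤s (*-monoˡ-≤ d (≤-pred j≤k))
    tooBigForFewer′ : ∀ j → j < k → j * d < k * d
    tooBigForFewer′ j j<k = *-monoˡ-< d j<k
theorem13 (suc (suc (suc _))) zero _ _ () _ _ _
theorem13 2 _ (s≤s (s≤s ())) _ _ _ _ _
theorem13 1 _ (s≤s ()) _ _ _ _ _
theorem13 0 _ () _ _ _ _ _
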